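{- For no nonnegative integer $n$ does there exist a cyclic Hesse Kaleidoscope of order $6n+3$.
   Context: A Hesse plane is a 2-$(9,3,1)$ design (the affine plane AG$(2,3)$), which has twelve lines. A Hesse Kaleidoscope of order $v$, HK$(v)$, is a set $\mathcal H$ of Hesse planes whose points lie in a $v$-set $\mathcal V$, the twelve lines of each plane colored with twelve distinct colors $c_0,\dots,c_{11}$, such that for any two distinct points $x,y\in\mathcal V$ and any color $c_i$ there is exactly one plane of $\mathcal H$ whose $c_i$-colored line contains $x$ and $y$. An HK$(v)$ is cyclic if $\mathcal V$ can be identified with $\mathbb{Z}_v$ so that the collection of colored planes is invariant under the translations $x\mapsto x+g$, $g\in\mathbb{Z}_v$ (i.e. it is $\mathbb{Z}_v$-regular). -}

module Defs where

open import Data.Nat using (ℕ; NonZero; _+_; _*_)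
open import Data.Nat.DivMod using (_mod_)
open import Data.Fin using (Fin; toℕ)
open import Data.Fin.Subset using (Subset; _∈_; ∣_∣; ⋃)
open import Data.List using (List)
open import Data.Vec using (lookup)
open import Data.Vec.Functional using (toList)
open import Data.Product using (Σ; _×_)
open import Relation.Binary.PropositionalEquality using (_≡_; _≢_)

ExactlyOne : ∀ {m} → (Fin m → Set) → Set
ExactlyOne {m} P = Σ (Fin m) λ j → P j × (∀ k → P k → k ≡ j)

-- A colored plane with points in ℤ_v (= Fin v): line of color c is a subset of ℤ_v.
ColoredPlane : ℕ → Set
ColoredPlane v = Fin 12 → Subset v

points : ∀ {v} → ColoredPlane v → Subset v
points L = ⋃ (toList L)

-- The twelve (colored) lines form a 2-(9,3,1) design, i.e. a Hesse plane AG(2,3):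
-- 9 points, every line has 3 points, any two distinct points lie on exactly one line.
IsHessePlane : ∀ {v} → ColoredPlane v → Set
IsHessePlane {v} L =
  (∣ points L ∣ ≡ 9) ×
  (∀ c → ∣ L c ∣ ≡ 3) ×
  (∀ (x y : Fin v) → x ∈ points L → y ∈ points L → x ≢ y →
     ExactlyOne (λ c → x ∈ L c × y ∈ L c))

-- Hesse Kaleidoscope on ℤ_v, given as a (duplicate-free, by the exactly-one condition)
-- family of colored planes indexed by Fin m.
IsHK : ∀ {v m} → (Fin m → ColoredPlane v) → Set
IsHK {v} H =
  (∀ i → IsHessePlane (H i)) ×
  (∀ (x y : Fin v) → x ≢ y → ∀ (c : Fin 12) →
     ExactlyOne (λ i → x ∈ H i c × y ∈ H i c))

_⊕_ : ∀ {v} .{{_ : NonZero v}} → Fin v → Fin v → Fin v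
_⊕_ {v} x g = (toℕ x + toℕ g) mod v

-- Invariance under all translations x ↦ x + g (colors preserved):
-- for each plane i and g, the translate of H i (line c ↦ line c + g) is some H j.
IsCyclic : ∀ {v m} .{{_ : NonZero v}} → (Fin m → ColoredPlane v) → Set
IsCyclic {v} H =
  ∀ i (g : Fin v) → Σ _ λ j → ∀ (c : Fin 12) (x : Fin v) →
    lookup (H j c) (x ⊕ g) ≡ lookup (H i c) x

-- Let H be a cyclic HK(v) on ℤ_v and fix one colour c₀.  For x ≠ 0 the c₀-coloured
-- line through 0 and x (it lies in exactly one plane) has a third point b; put
-- ρ(x) = b - x and ρ(0) = 0.  Translating the line {0, x, b} by -x gives the
-- c₀-coloured line {0, b - x, -x} of another plane, so ρ(b - x) = -x - (b - x), and
-- after three such rotations ρ³ = id.  A fixed point x ≠ 0 of ρ would give the line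
-- {0, x, 2x}; its plane is then carried to itself, colour by colour, by the
-- translation by x, but a colour-preserving translation of a Hesse plane is trivial.
-- So ρ is a map of order three on ℤ_v whose only fixed point is 0, and counting its
-- orbits gives v ≡ 1 (mod 3), whereas 6n + 3 ≡ 0 (mod 3).
module Submission where

open import Defs
open import Level using (0ℓ)
open import Data.Bool using (if_then_else_; _∧_)
open import Data.Bool.Properties using (∧-zeroʳ)
open import Data.Nat as ℕ using (ℕ; zero; suc; _+_; _*_; _∸_; _%_; z≤n; s≤s)
import Data.Nat.Properties as ℕ
open import Data.Nat.Tactic.RingSolver using (solve-∀)
open import Data.Nat.DivMod using (_mod_; %-distribˡ-+; m%n%n≡m%n; m<n⇒m%n≡m; n%n≡0; [m+kn]%n≡m%n; m*n%n≡0)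
open import Data.Fin.Permutation using (permutation)
open import Data.Vec.Functional using (removeAt)
open import Algebra.Properties.CommutativeMonoid.Sum ℕ.+-0-commutativeMonoid
  using (sum; ∑-permute; ∑-distrib-+; sum-remove; sum-cong-≗)
open import Data.Fin as Fin using (Fin; toℕ)
import Data.Fin.Properties as Fin
open import Data.Product using (Σ; ∃; _×_; _,_; proj₁; proj₂)
open import Relation.Binary.PropositionalEquality
  using (_≡_; _≢_; refl; sym; trans; cong; cong₂; subst; subst₂; ≢-sym; isEquivalence; module ≡-Reasoning)
open import Algebra.Structures using (IsAbelianGroup)
open import Algebra.Bundles using (AbelianGroup)
import Algebra.Properties.AbelianGroup as AbelianGroupProperties
open import Data.Fin.Subset using (Subset; _∈_; _∉_; _⊆_; ∣_∣; ⁅_⁆; _─_; _-_; ⋃; inside; outside; Nonempty)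
open import Data.Fin.Subset.Properties
  using (nonempty?; Empty-unique; p─⊥≡p; p─q⊆p; x∈p∧x≢y⇒x∈p-y; x∉⁅y⁆⇒x≢y; x∈p⇒∣p-x∣<∣p∣;
         p⊆q⇒∣p∣≤∣q∣; ∣⊥∣≡0; x∈p∪q⁺)
open import Data.Vec using (_∷_; here; there)
open import Data.Vec.Properties using ([]=⇒lookup; lookup⇒[]=)
open import Data.List using (tabulate)
open import Data.Sum using (inj₁; inj₂)
open import Relation.Nullary using (¬_; Dec; yes; no; does)
open import Relation.Nullary.Decidable using (dec-true; dec-false)
open import Relation.Binary.Definitions using (tri<; tri≈; tri>)
open import Data.Empty using (⊥-elim)

module ℤmod (k : ℕ) where

  private
    V : ℕ
    V = suc k

  neg : Fin V → Fin V
  neg x = (V ∸ toℕ x) mod V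

  toℕ-⊕ : ∀ x y → toℕ (x ⊕ y) ≡ (toℕ x + toℕ y) % V
  toℕ-⊕ x y = Fin.toℕ-fromℕ< _

  ≡-mod : ∀ a b → a % V ≡ b % V → a mod V ≡ b mod V
  ≡-mod a b eq = Fin.toℕ-injective (begin
    toℕ (a mod V) ≡⟨ Fin.toℕ-fromℕ< _ ⟩
    a % V         ≡⟨ eq ⟩
    b % V         ≡⟨ Fin.toℕ-fromℕ< _ ⟨
    toℕ (b mod V) ∎)
    where open ≡-Reasoning

  %-absorbˡ : ∀ a b → (a % V + b) % V ≡ (a + b) % V
  %-absorbˡ a b = begin
    (a % V + b) % V           ≡⟨ %-distribˡ-+ (a % V) b V ⟩
    (a % V % V + b % V) % V   ≡⟨ cong (λ t → (t + b % V) % V) (m%n%n≡m%n a V) ⟩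
    (a % V + b % V) % V       ≡⟨ %-distribˡ-+ a b V ⟨
    (a + b) % V               ∎
    where open ≡-Reasoning

  %-absorbʳ : ∀ a b → (a + b % V) % V ≡ (a + b) % V
  %-absorbʳ a b = begin
    (a + b % V) % V ≡⟨ cong (_% V) (ℕ.+-comm a (b % V)) ⟩
    (b % V + a) % V ≡⟨ %-absorbˡ b a ⟩
    (b + a) % V     ≡⟨ cong (_% V) (ℕ.+-comm b a) ⟩
    (a + b) % V     ∎
    where open ≡-Reasoning

  ⊕-comm : ∀ x y → x ⊕ y ≡ y ⊕ x
  ⊕-comm x y = cong (_mod V) (ℕ.+-comm (toℕ x) (toℕ y))

  ⊕-assoc : ∀ x y z → (x ⊕ y) ⊕ z ≡ x ⊕ (y ⊕ z)
  ⊕-assoc x y z = ≡-mod (toℕ (x ⊕ y) + toℕ z) (toℕ x + toℕ (y ⊕ z)) (begin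
    (toℕ (x ⊕ y) + toℕ z) % V          ≡⟨ cong (λ t → (t + toℕ z) % V) (toℕ-⊕ x y) ⟩
    ((toℕ x + toℕ y) % V + toℕ z) % V  ≡⟨ %-absorbˡ (toℕ x + toℕ y) (toℕ z) ⟩
    (toℕ x + toℕ y + toℕ z) % V        ≡⟨ cong (_% V) (ℕ.+-assoc (toℕ x) (toℕ y) (toℕ z)) ⟩
    (toℕ x + (toℕ y + toℕ z)) % V      ≡⟨ %-absorbʳ (toℕ x) (toℕ y + toℕ z) ⟨
    (toℕ x + (toℕ y + toℕ z) % V) % V  ≡⟨ cong (λ t → (toℕ x + t) % V) (toℕ-⊕ y z) ⟨
    (toℕ x + toℕ (y ⊕ z)) % V          ∎)
    where open ≡-Reasoning

  ⊕-identityʳ : ∀ x → x ⊕ Fin.zero ≡ x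
  ⊕-identityʳ x = Fin.toℕ-injective (begin
    toℕ (x ⊕ Fin.zero)   ≡⟨ toℕ-⊕ x Fin.zero ⟩
    (toℕ x + 0) % V      ≡⟨ cong (_% V) (ℕ.+-identityʳ (toℕ x)) ⟩
    toℕ x % V            ≡⟨ m<n⇒m%n≡m (Fin.toℕ<n x) ⟩
    toℕ x                ∎)
    where open ≡-Reasoning

  ⊕-inverseʳ : ∀ x → x ⊕ neg x ≡ Fin.zero
  ⊕-inverseʳ x = Fin.toℕ-injective (begin
    toℕ (x ⊕ neg x)                  ≡⟨ toℕ-⊕ x (neg x) ⟩
    (toℕ x + toℕ (neg x)) % V        ≡⟨ cong (λ t → (toℕ x + t) % V) (Fin.toℕ-fromℕ< _) ⟩
    (toℕ x + (V ∸ toℕ x) % V) % V    ≡⟨ %-absorbʳ (toℕ x) (V ∸ toℕ x) ⟩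
    (toℕ x + (V ∸ toℕ x)) % V        ≡⟨ cong (_% V) (ℕ.m+[n∸m]≡n (ℕ.<⇒≤ (Fin.toℕ<n x))) ⟩
    V % V                            ≡⟨ n%n≡0 V ⟩
    0                                ∎)
    where open ≡-Reasoning

  isAbelianGroup : IsAbelianGroup _≡_ _⊕_ Fin.zero neg
  isAbelianGroup = record
    { isGroup = record
      { isMonoid = record
        { isSemigroup = record
          { isMagma = record { isEquivalence = isEquivalence ; ∙-cong = cong₂ _⊕_ }
          ; assoc = ⊕-assoc
          }
        ; identity = (λ x → trans (⊕-comm Fin.zero x) (⊕-identityʳ x)) , ⊕-identityʳ
        }
      ; inverse = (λ x → trans (⊕-comm (neg x) x) (⊕-inverseʳ x)) , ⊕-inverseʳ
      ; ⁻¹-cong = cong neg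
      }
    ; comm = ⊕-comm
    }

  abelianGroup : AbelianGroup 0ℓ 0ℓ
  abelianGroup = record { isAbelianGroup = isAbelianGroup }

module AbelianGroupIdentities {a ℓ} (G : AbelianGroup a ℓ) where

  open AbelianGroup G
    using (_≈_; _∙_; ε; _⁻¹; setoid; ∙-congˡ; ∙-congʳ; ⁻¹-cong; assoc; comm; identityˡ; identityʳ; inverseˡ)
    renaming (_-_ to _⊖_)
  open AbelianGroupProperties G using (⁻¹-involutive; ⁻¹-∙-comm)
  open import Relation.Binary.Reasoning.Setoid setoid

  -- Three rotations of a triangle {0, a, b} ↦ {0, b - a, -a} return to the start.
  rotate³ : ∀ u x → u ⁻¹ ⊖ (x ⁻¹ ⊖ u) ≈ x
  rotate³ u x = begin
    u ⁻¹ ∙ (x ⁻¹ ∙ u ⁻¹) ⁻¹   ≈⟨ ∙-congˡ (⁻¹-cong (⁻¹-∙-comm x u)) ⟩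
    u ⁻¹ ∙ (x ∙ u) ⁻¹ ⁻¹      ≈⟨ ∙-congˡ (⁻¹-involutive (x ∙ u)) ⟩
    u ⁻¹ ∙ (x ∙ u)            ≈⟨ ∙-congˡ (comm x u) ⟩
    u ⁻¹ ∙ (u ∙ x)            ≈⟨ assoc (u ⁻¹) u x ⟨
    u ⁻¹ ∙ u ∙ x              ≈⟨ ∙-congʳ (inverseˡ u) ⟩
    ε ∙ x                     ≈⟨ identityˡ x ⟩
    x                         ∎

  ⊖-∙-cancel : ∀ y x → (y ⊖ x) ∙ x ≈ y
  ⊖-∙-cancel y x = begin
    y ∙ x ⁻¹ ∙ x      ≈⟨ assoc y (x ⁻¹) x ⟩
    y ∙ (x ⁻¹ ∙ x)    ≈⟨ ∙-congˡ (inverseˡ x) ⟩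
    y ∙ ε             ≈⟨ identityʳ y ⟩
    y                 ∎

∣p∣≡1+∣p-x∣ : ∀ {n} {x : Fin n} {p : Subset n} → x ∈ p → ∣ p ∣ ≡ suc ∣ p - x ∣
∣p∣≡1+∣p-x∣ {x = Fin.zero}  {inside ∷ p}  here      = cong (λ q → suc ∣ q ∣) (sym (p─⊥≡p p))
∣p∣≡1+∣p-x∣ {x = Fin.suc x} {inside ∷ p}  (there m) = cong suc (∣p∣≡1+∣p-x∣ m)
∣p∣≡1+∣p-x∣ {x = Fin.suc x} {outside ∷ p} (there m) = ∣p∣≡1+∣p-x∣ m

x∈p─q⇒x∉q : ∀ {n} {x : Fin n} (p q : Subset n) → x ∈ p ─ q → x ∉ q
x∈p─q⇒x∉q (inside ∷ p) (outside ∷ q) here      ()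
x∈p─q⇒x∉q (_ ∷ p)      (_ ∷ q)       (there m) (there x∈q) = x∈p─q⇒x∉q p q m x∈q

x∈p-y⁻ : ∀ {n} {x y : Fin n} {p : Subset n} → x ∈ p - y → x ∈ p × x ≢ y
x∈p-y⁻ {y = y} {p} x∈p-y = p─q⊆p p ⁅ y ⁆ x∈p-y , x∉⁅y⁆⇒x≢y (x∈p─q⇒x∉q p ⁅ y ⁆ x∈p-y)

nonempty-if-positive : ∀ {n} {p : Subset n} → 0 ℕ.< ∣ p ∣ → Nonempty p
nonempty-if-positive {n} {p} 0<∣p∣ with nonempty? p
... | yes p-nonempty = p-nonempty
... | no  p-empty    = ⊥-elim (ℕ.<⇒≢ 0<∣p∣ (sym (trans (cong ∣_∣ (Empty-unique p-empty)) (∣⊥∣≡0 n))))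

third-member : ∀ {n} {p : Subset n} {a b} → ∣ p ∣ ≡ 3 → a ∈ p → b ∈ p → a ≢ b →
               ∃ λ c → c ∈ p × c ≢ a × c ≢ b
third-member {p = p} {a} {b} ∣p∣≡3 a∈p b∈p a≢b with nonempty-if-positive {p = p - a - b} 0<∣p-a-b∣
  where
  ∣p-a-b∣≡1 : ∣ p - a - b ∣ ≡ 1
  ∣p-a-b∣≡1 = ℕ.suc-injective (ℕ.suc-injective (begin
    suc (suc ∣ p - a - b ∣) ≡⟨ cong suc (∣p∣≡1+∣p-x∣ (x∈p∧x≢y⇒x∈p-y b∈p (≢-sym a≢b))) ⟨
    suc ∣ p - a ∣           ≡⟨ ∣p∣≡1+∣p-x∣ a∈p ⟨
    ∣ p ∣                   ≡⟨ ∣p∣≡3 ⟩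
    3                       ∎))
    where open ≡-Reasoning
  0<∣p-a-b∣ : 0 ℕ.< ∣ p - a - b ∣
  0<∣p-a-b∣ = subst (0 ℕ.<_) (sym ∣p-a-b∣≡1) (s≤s z≤n)
... | c , c∈p-a-b with x∈p-y⁻ c∈p-a-b
...   | c∈p-a , c≢b with x∈p-y⁻ c∈p-a
...     | c∈p , c≢a = c , c∈p , c≢a , c≢b

four-members : ∀ {n} {p : Subset n} {a b c d} → a ∈ p → b ∈ p → c ∈ p → d ∈ p →
               a ≢ b → a ≢ c → a ≢ d → b ≢ c → b ≢ d → c ≢ d → 4 ℕ.≤ ∣ p ∣
four-members {p = p} {a} {b} {c} {d} a∈p b∈p c∈p d∈p a≢b a≢c a≢d b≢c b≢d c≢d =
  ℕ.≤-<-trans (ℕ.≤-<-trans (ℕ.≤-<-trans 0<∣p-a-b-c∣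
    (x∈p⇒∣p-x∣<∣p∣ c∈p-a-b)) (x∈p⇒∣p-x∣<∣p∣ b∈p-a)) (x∈p⇒∣p-x∣<∣p∣ a∈p)
  where
  b∈p-a : b ∈ p - a
  b∈p-a = x∈p∧x≢y⇒x∈p-y b∈p (≢-sym a≢b)
  c∈p-a-b : c ∈ p - a - b
  c∈p-a-b = x∈p∧x≢y⇒x∈p-y (x∈p∧x≢y⇒x∈p-y c∈p (≢-sym a≢c)) (≢-sym b≢c)
  d∈p-a-b-c : d ∈ p - a - b - c
  d∈p-a-b-c = x∈p∧x≢y⇒x∈p-y (x∈p∧x≢y⇒x∈p-y (x∈p∧x≢y⇒x∈p-y d∈p (≢-sym a≢d)) (≢-sym b≢d)) (≢-sym c≢d)
  0<∣p-a-b-c∣ : 0 ℕ.< ∣ p - a - b - c ∣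
  0<∣p-a-b-c∣ = ℕ.≤-<-trans z≤n (x∈p⇒∣p-x∣<∣p∣ d∈p-a-b-c)

⊆-⋃-tabulate : ∀ {n v} (L : Fin n → Subset v) c → L c ⊆ ⋃ (tabulate L)
⊆-⋃-tabulate L Fin.zero    x∈Lc = x∈p∪q⁺ (inj₁ x∈Lc)
⊆-⋃-tabulate L (Fin.suc c) x∈Lc = x∈p∪q⁺ (inj₂ (⊆-⋃-tabulate (λ i → L (Fin.suc i)) c x∈Lc))

exactlyOne-unique : ∀ {m} {P : Fin m → Set} → ExactlyOne P → ∀ {i j} → P i → P j → i ≡ j
exactlyOne-unique (_ , _ , only) Pi Pj = trans (only _ Pi) (sym (only _ Pj))

-- A colour-preserving translation of a Hesse plane is trivial on it: if the map
-- z ↦ z ⊕ g sends every line of P into itself, it fixes every point of P.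
-- Otherwise, for z on line c with z ⊕ g ≠ z and a point a off line c, the line d
-- through z and a also contains z ⊕ g, so d = c and a would lie on line c.
hesse-translation-trivial : ∀ {v} .{{_ : ℕ.NonZero v}} {P : ColoredPlane v} {g z : Fin v} {c} →
  IsHessePlane P → (∀ d y → y ∈ P d → y ⊕ g ∈ P d) → z ∈ P c → z ⊕ g ≡ z
hesse-translation-trivial {P = P} {g} {z} {c} (∣points∣≡9 , ∣line∣≡3 , line-through) invariant z∈Pc
  with (z ⊕ g) Fin.≟ z
... | yes fixed = fixed
... | no  moved = ⊥-elim (ℕ.<⇒≱ ∣Pc∣<∣points∣ (p⊆q⇒∣p∣≤∣q∣ points⊆Pc))
  where
  ∣Pc∣<∣points∣ : ∣ P c ∣ ℕ.< ∣ points P ∣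
  ∣Pc∣<∣points∣ = subst₂ ℕ._<_ (sym (∣line∣≡3 c)) (sym ∣points∣≡9) (s≤s (s≤s (s≤s (s≤s z≤n))))
  on-P : ∀ {x d} → x ∈ P d → x ∈ points P
  on-P {d = d} = ⊆-⋃-tabulate P d
  -- The lines c and d through z both contain z ⊕ g ≠ z, hence coincide.
  line-through-z : ∀ {d} → z ∈ P d → d ≡ c
  line-through-z {d} z∈Pd =
    exactlyOne-unique (line-through z (z ⊕ g) (on-P z∈Pc) (on-P (invariant c z z∈Pc)) (≢-sym moved))
      (z∈Pd , invariant d z z∈Pd) (z∈Pc , invariant c z z∈Pc)
  points⊆Pc : points P ⊆ P c
  points⊆Pc {a} a∈P with a Fin.≟ z
  ... | yes refl = z∈Pc
  ... | no  a≢z with line-through z a (on-P z∈Pc) a∈P (≢-sym a≢z)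
  ...   | d , (z∈Pd , a∈Pd) , _ = subst (λ d → a ∈ P d) (line-through-z z∈Pd) a∈Pd

isLeast : ∀ {N} → Fin N → Fin N → Fin N → ℕ
isLeast a b c = if does (a Fin.<? b) ∧ does (a Fin.<? c) then 1 else 0

isLeast-≡1 : ∀ {N} {a b c : Fin N} → a Fin.< b → a Fin.< c → isLeast a b c ≡ 1
isLeast-≡1 {a = a} {b} {c} a<b a<c rewrite dec-true (a Fin.<? b) a<b | dec-true (a Fin.<? c) a<c = refl

isLeast-≡0ˡ : ∀ {N} {a b c : Fin N} → ¬ a Fin.< b → isLeast a b c ≡ 0
isLeast-≡0ˡ {a = a} {b} a≮b rewrite dec-false (a Fin.<? b) a≮b = refl

isLeast-≡0ʳ : ∀ {N} {a b c : Fin N} → ¬ a Fin.< c → isLeast a b c ≡ 0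
isLeast-≡0ʳ {a = a} {b} {c} a≮c rewrite dec-false (a Fin.<? c) a≮c | ∧-zeroʳ (does (a Fin.<? b)) = refl

leastCount : ∀ {N} → Fin N → Fin N → Fin N → ℕ
leastCount a b c = isLeast a b c + isLeast b c a + isLeast c a b

leastCount-rotate : ∀ {N} (a b c : Fin N) → leastCount a b c ≡ leastCount b c a
leastCount-rotate a b c = begin
  isLeast a b c + isLeast b c a + isLeast c a b    ≡⟨ ℕ.+-assoc (isLeast a b c) _ _ ⟩
  isLeast a b c + (isLeast b c a + isLeast c a b)  ≡⟨ ℕ.+-comm (isLeast a b c) _ ⟩
  isLeast b c a + isLeast c a b + isLeast a b c    ∎
  where open ≡-Reasoning

leastCount-least : ∀ {N} {a b c : Fin N} → a Fin.< b → a Fin.< c → leastCount a b c ≡ 1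
leastCount-least {a = a} {b} {c} a<b a<c =
  cong₂ _+_ (cong₂ _+_ (isLeast-≡1 a<b a<c) (isLeast-≡0ʳ {b = c} (Fin.<-asym a<b)))
            (isLeast-≡0ˡ {c = b} (Fin.<-asym a<c))

leastCount-distinct : ∀ {N} {a b c : Fin N} → a ≢ b → b ≢ c → a ≢ c → leastCount a b c ≡ 1
leastCount-distinct {a = a} {b} {c} a≢b b≢c a≢c with Fin.<-cmp a b | Fin.<-cmp a c | Fin.<-cmp b c
... | tri≈ _ a≡b _ | _ | _ = ⊥-elim (a≢b a≡b)
... | _ | tri≈ _ a≡c _ | _ = ⊥-elim (a≢c a≡c)
... | _ | _ | tri≈ _ b≡c _ = ⊥-elim (b≢c b≡c)
... | tri< a<b _ _ | tri< a<c _ _ | _ = leastCount-least a<b a<c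
... | _ | tri> _ _ c<a | tri> _ _ c<b = trans (leastCount-rotate a b c) (trans (leastCount-rotate b c a) (leastCount-least c<a c<b))
... | tri> _ _ b<a | _ | tri< b<c _ _ = trans (leastCount-rotate a b c) (leastCount-least b<c b<a)
... | tri< a<b _ _ | tri> _ _ c<a | tri< b<c _ _ = ⊥-elim (Fin.<-asym (Fin.<-trans a<b b<c) c<a)
... | tri> _ _ b<a | tri< a<c _ _ | tri> _ _ c<b = ⊥-elim (Fin.<-asym (Fin.<-trans c<b b<a) a<c)

leastCount-diagonal : ∀ {N} (a : Fin N) → leastCount a a a ≡ 0
leastCount-diagonal a rewrite isLeast-≡0ˡ {c = a} (Fin.<-irrefl {x = a} refl) = refl

order3-orbit-distinct : ∀ {A : Set} (f : A → A) → (∀ x → f (f (f x)) ≡ x) → ∀ {x} → f x ≢ x →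
                        x ≢ f x × f x ≢ f (f x) × x ≢ f (f x)
order3-orbit-distinct f f³≡id {x} moved =
    (λ x≡fx → moved (sym x≡fx))
  , (λ fx≡ffx → moved (trans fx≡ffx (trans (cong f fx≡ffx) (f³≡id x))))
  , (λ x≡ffx → moved (trans (cong f x≡ffx) (f³≡id x)))

sum-ones : ∀ N → sum {N} (λ _ → 1) ≡ N
sum-ones zero    = refl
sum-ones (suc N) = cong suc (sum-ones N)

-- Counting orbits of a map f of order three on Fin N: summing, over all points x,
-- the indicator that x is the least point of its orbit {x, f x, f (f x)}.
module Order3Orbits {N} (f : Fin N → Fin N) (f³≡id : ∀ x → f (f (f x)) ≡ x) where

  least : Fin N → ℕ
  least x = isLeast x (f x) (f (f x))

  orbits : ℕ
  orbits = sum least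

  sum-∘f : ∀ h → sum (λ x → h (f x)) ≡ sum h
  sum-∘f h = sym (∑-permute h (permutation f (λ x → f (f x)) f³≡id f³≡id))

  orbitCount : Fin N → ℕ
  orbitCount x = least x + least (f x) + least (f (f x))

  orbitCount≡leastCount : ∀ x → orbitCount x ≡ leastCount x (f x) (f (f x))
  orbitCount≡leastCount x =
    cong₂ (λ s t → least x + isLeast (f x) (f (f x)) s + isLeast (f (f x)) s t) (f³≡id x) (cong f (f³≡id x))

  orbitCount-moved : ∀ {x} → f x ≢ x → orbitCount x ≡ 1
  orbitCount-moved {x} moved with order3-orbit-distinct f f³≡id moved
  ... | x≢fx , fx≢ffx , x≢ffx = trans (orbitCount≡leastCount x) (leastCount-distinct x≢fx fx≢ffx x≢ffx)

  orbitCount-fixed : ∀ {z} → f z ≡ z → orbitCount z ≡ 0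
  orbitCount-fixed {z} fz≡z = begin
    orbitCount z                  ≡⟨ orbitCount≡leastCount z ⟩
    leastCount z (f z) (f (f z))  ≡⟨ cong₂ (leastCount z) fz≡z (trans (cong f fz≡z) fz≡z) ⟩
    leastCount z z z              ≡⟨ leastCount-diagonal z ⟩
    0                             ∎
    where open ≡-Reasoning

  -- Each of the three summands of orbitCount sums to the number of orbits.
  sum-orbitCount : sum orbitCount ≡ 3 * orbits
  sum-orbitCount = begin
    sum orbitCount
      ≡⟨ ∑-distrib-+ (λ x → least x + least (f x)) (λ x → least (f (f x))) ⟩
    sum (λ x → least x + least (f x)) + sum (λ x → least (f (f x)))
      ≡⟨ cong (_+ sum (λ x → least (f (f x)))) (∑-distrib-+ least (λ x → least (f x))) ⟩
    orbits + sum (λ x → least (f x)) + sum (λ x → least (f (f x)))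
      ≡⟨ cong₂ (λ s t → orbits + s + t) (sum-∘f least) (trans (sum-∘f (λ x → least (f x))) (sum-∘f least)) ⟩
    orbits + orbits + orbits
      ≡⟨ ℕ.+-assoc orbits orbits orbits ⟩
    orbits + (orbits + orbits)
      ≡⟨ cong (λ t → orbits + (orbits + t)) (ℕ.+-identityʳ orbits) ⟨
    3 * orbits
      ∎
    where open ≡-Reasoning

-- A map of order three on Fin N with exactly one fixed point forces N ≡ 1 (mod 3):
-- the remaining N - 1 points split into orbits of size three.
order3-unique-fixed-point : ∀ {N} (f : Fin N → Fin N) (z : Fin N) → (∀ x → f (f (f x)) ≡ x) →
                            f z ≡ z → (∀ x → f x ≡ x → x ≡ z) → N % 3 ≡ 1
order3-unique-fixed-point {suc N} f z f³≡id fz≡z fixed⇒z = begin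
  suc N % 3             ≡⟨ cong (λ t → suc t % 3) (trans (sym sum-orbitCount≡N) sum-orbitCount) ⟩
  (1 + 3 * orbits) % 3  ≡⟨ cong (λ t → (1 + t) % 3) (ℕ.*-comm 3 orbits) ⟩
  (1 + orbits * 3) % 3  ≡⟨ [m+kn]%n≡m%n 1 orbits 3 ⟩
  1                     ∎
  where
  open ≡-Reasoning
  open Order3Orbits f f³≡id
  sum-orbitCount≡N : sum orbitCount ≡ N
  sum-orbitCount≡N = begin
    sum orbitCount                              ≡⟨ sum-remove {i = z} orbitCount ⟩
    orbitCount z + sum (removeAt orbitCount z)  ≡⟨ cong (_+ sum (removeAt orbitCount z)) (orbitCount-fixed fz≡z) ⟩
    sum (removeAt orbitCount z)                 ≡⟨ sum-cong-≗ (λ i → orbitCount-moved (moved (Fin.punchInᵢ≢i z i))) ⟩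
    sum {N} (λ _ → 1)                           ≡⟨ sum-ones N ⟩
    N                                           ∎
    where
    moved : ∀ {x} → x ≢ z → f x ≢ x
    moved x≢z fx≡x = x≢z (fixed⇒z _ fx≡x)

module CyclicHK {k m : ℕ} (H : Fin m → ColoredPlane (suc k)) (isHK : IsHK H) (cyclic : IsCyclic H) where

  open AbelianGroup (ℤmod.abelianGroup k)
    using (ε; _⁻¹; _∙_; identityˡ; inverseʳ)
    renaming (_-_ to _⊖_)
  open AbelianGroupProperties (ℤmod.abelianGroup k)
    using (∙-cancelʳ; ε⁻¹≈ε; ⁻¹-injective; x∙y⁻¹≈ε⇒x≈y)
  open AbelianGroupIdentities (ℤmod.abelianGroup k) using (rotate³; ⊖-∙-cancel)

  private
    V : ℕ
    V = suc k

  c₀ : Fin 12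
  c₀ = Fin.zero

  record BaseLine (i : Fin m) (a b : Fin V) : Set where
    field
      ε∈  : ε ∈ H i c₀
      a∈  : a ∈ H i c₀
      b∈  : b ∈ H i c₀
      a≢ε : a ≢ ε
      b≢ε : b ≢ ε
      a≢b : a ≢ b

  translate : Fin m → Fin V → Fin m
  translate i g = proj₁ (cyclic i g)

  ∈-translate : ∀ {i c z} g → z ∈ H i c → z ∙ g ∈ H (translate i g) c
  ∈-translate {i} {c} {z} g z∈Hic = lookup⇒[]= _ _ (trans (proj₂ (cyclic i g) c z) ([]=⇒lookup z∈Hic))

  same-plane : ∀ {x y i j c} → x ≢ y → x ∈ H i c → y ∈ H i c → x ∈ H j c → y ∈ H j c → i ≡ j
  same-plane x≢y x∈i y∈i x∈j y∈j = exactlyOne-unique (proj₂ isHK _ _ x≢y _) (x∈i , y∈i) (x∈j , y∈j)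

  line-size : ∀ i c → ∣ H i c ∣ ≡ 3
  line-size i = proj₁ (proj₂ (proj₁ isHK i))

  baseLine-exists : ∀ {a} → a ≢ ε → Σ (Fin V) λ b → Σ (Fin m) λ i → BaseLine i a b
  baseLine-exists {a} a≢ε with proj₂ isHK ε a (≢-sym a≢ε) c₀
  ... | i , (ε∈ , a∈) , _ with third-member (line-size i c₀) ε∈ a∈ (≢-sym a≢ε)
  ...   | b , b∈ , b≢ε , b≢a = b , i , record
          { ε∈ = ε∈ ; a∈ = a∈ ; b∈ = b∈ ; a≢ε = a≢ε ; b≢ε = b≢ε ; a≢b = ≢-sym b≢a }

  -- ... and this b is determined by a: a line has only three points.
  baseLine-unique : ∀ {i j a b b′} → BaseLine i a b → BaseLine j a b′ → b ≡ b′
  baseLine-unique {i} {j} {b = b} {b′} L L′ with b Fin.≟ b′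
  ... | yes b≡b′ = b≡b′
  ... | no  b≢b′ = ⊥-elim (ℕ.<-irrefl (sym (line-size i c₀)) (four-members
          (ε∈ L) (a∈ L) (b∈ L) (subst (λ l → b′ ∈ H l c₀) (sym i≡j) (b∈ L′))
          (≢-sym (a≢ε L)) (≢-sym (b≢ε L)) (≢-sym (b≢ε L′)) (a≢b L) (a≢b L′) b≢b′))
    where
    open BaseLine
    i≡j : i ≡ j
    i≡j = same-plane (≢-sym (a≢ε L)) (ε∈ L) (a∈ L) (ε∈ L′) (a∈ L′)

  third : Fin V → Fin V
  third a with a Fin.≟ ε
  ... | yes _   = ε
  ... | no  a≢ε = proj₁ (baseLine-exists a≢ε)

  third-baseLine : ∀ {i a b} → BaseLine i a b → third a ≡ b
  third-baseLine {a = a} L with a Fin.≟ ε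
  ... | yes a≡ε = ⊥-elim (BaseLine.a≢ε L a≡ε)
  ... | no  a≢ε = baseLine-unique (proj₂ (proj₂ (baseLine-exists a≢ε))) L

  -- The rotation map: the base line {ε, a, b} translated by a ⁻¹ is {ε, b ⊖ a, a ⁻¹},
  -- and ρ sends a to the next point b ⊖ a of that rotated triangle.
  ρ : Fin V → Fin V
  ρ a = third a ⊖ a

  ρ-baseLine : ∀ {i a b} → BaseLine i a b → ρ a ≡ b ⊖ a
  ρ-baseLine {a = a} L = cong (_⊖ a) (third-baseLine L)

  ρ-ε : ρ ε ≡ ε
  ρ-ε with ε Fin.≟ ε
  ... | yes _   = inverseʳ ε
  ... | no  ε≢ε = ⊥-elim (ε≢ε refl)

  baseLine-rotate : ∀ {i a b} → BaseLine i a b → Σ (Fin m) λ j → BaseLine j (b ⊖ a) (a ⁻¹)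
  baseLine-rotate {i} {a} {b} L = translate i (a ⁻¹) , record
    { ε∈  = subst (_∈ H j c₀) (inverseʳ a) (∈-translate (a ⁻¹) (a∈ L))
    ; a∈  = ∈-translate (a ⁻¹) (b∈ L)
    ; b∈  = subst (_∈ H j c₀) (identityˡ (a ⁻¹)) (∈-translate (a ⁻¹) (ε∈ L))
    ; a≢ε = λ b⊖a≡ε → a≢b L (sym (x∙y⁻¹≈ε⇒x≈y b a b⊖a≡ε))
    ; b≢ε = λ a⁻¹≡ε → a≢ε L (⁻¹-injective (trans a⁻¹≡ε (sym ε⁻¹≈ε)))
    ; a≢b = λ b⊖a≡a⁻¹ → b≢ε L (∙-cancelʳ (a ⁻¹) b ε (trans b⊖a≡a⁻¹ (sym (identityˡ (a ⁻¹)))))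
    }
    where
    open BaseLine
    j : Fin m
    j = translate i (a ⁻¹)

  -- ρ has order three: three rotations of the base line through x return to x.
  -- (The case split on x ≟ ε is made by a helper on Dec rather than by 'with',
  -- since abstracting over x ≟ ε would normalise the goal, which contains ρ.)
  ρ-order3 : ∀ x → ρ (ρ (ρ x)) ≡ x
  ρ-order3 x = by-cases (x Fin.≟ ε)
    where
    by-cases : Dec (x ≡ ε) → ρ (ρ (ρ x)) ≡ x
    by-cases (yes refl) = trans (cong (λ t → ρ (ρ t)) ρ-ε) (trans (cong ρ ρ-ε) ρ-ε)
    by-cases (no  x≢ε) with baseLine-exists x≢ε
    ... | b , i , L = begin
      ρ (ρ (ρ x))                   ≡⟨ cong (λ t → ρ (ρ t)) (ρ-baseLine L) ⟩
      ρ (ρ (b ⊖ x))                 ≡⟨ cong ρ (ρ-baseLine L₁) ⟩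
      ρ (x ⁻¹ ⊖ (b ⊖ x))            ≡⟨ ρ-baseLine L₂ ⟩
      (b ⊖ x) ⁻¹ ⊖ (x ⁻¹ ⊖ (b ⊖ x)) ≡⟨ rotate³ (b ⊖ x) x ⟩
      x                             ∎
      where
      open ≡-Reasoning
      L₁ : BaseLine (translate i (x ⁻¹)) (b ⊖ x) (x ⁻¹)
      L₁ = proj₂ (baseLine-rotate L)
      L₂ : BaseLine (translate (translate i (x ⁻¹)) ((b ⊖ x) ⁻¹)) (x ⁻¹ ⊖ (b ⊖ x)) ((b ⊖ x) ⁻¹)
      L₂ = proj₂ (baseLine-rotate L₁)

  -- The plane through a base line {ε, x, x ∙ x} is invariant under translation by x:
  -- its translate by x shares the points x and x ∙ x on the c₀-coloured line.
  baseLine-doubling-invariant : ∀ {i x} → BaseLine i x (x ∙ x) → ∀ d z → z ∈ H i d → z ∙ x ∈ H i d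
  baseLine-doubling-invariant {i} {x} L d z z∈Hid =
    subst (λ l → z ∙ x ∈ H l d) (sym i≡j) (∈-translate x z∈Hid)
    where
    open BaseLine L
    i≡j : i ≡ translate i x
    i≡j = same-plane a≢b a∈ b∈
      (subst (_∈ H (translate i x) c₀) (identityˡ x) (∈-translate x ε∈))
      (∈-translate x a∈)

  -- If ρ x = x ≠ ε then the base line through x is
  -- {ε, x, x ∙ x}, so its plane is invariant under translation by x; but a colour-
  -- preserving translation of a Hesse plane is trivial, forcing x = ε.
  ρ-fixed-point : ∀ x → ρ x ≡ x → x ≡ ε
  ρ-fixed-point x ρx≡x = by-cases (x Fin.≟ ε)
    where
    by-cases : Dec (x ≡ ε) → x ≡ ε
    by-cases (yes x≡ε) = x≡ε
    by-cases (no  x≢ε) with baseLine-exists x≢ε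
    ... | y , i , L = begin
      x      ≡⟨ identityˡ x ⟨
      ε ∙ x  ≡⟨ hesse-translation-trivial (proj₁ isHK i) (baseLine-doubling-invariant L′) (BaseLine.ε∈ L) ⟩
      ε      ∎
      where
      open ≡-Reasoning
      y≡x∙x : y ≡ x ∙ x
      y≡x∙x = begin
        y            ≡⟨ ⊖-∙-cancel y x ⟨
        (y ⊖ x) ∙ x  ≡⟨ cong (_∙ x) (trans (sym (ρ-baseLine L)) ρx≡x) ⟩
        x ∙ x        ∎
      L′ : BaseLine i x (x ∙ x)
      L′ = subst (BaseLine i x) y≡x∙x L

cyclicHK-order : ∀ {k m} (H : Fin m → ColoredPlane (suc k)) → IsHK H → IsCyclic H → suc k % 3 ≡ 1
cyclicHK-order H isHK cyclic = order3-unique-fixed-point ρ Fin.zero ρ-order3 ρ-ε ρ-fixed-point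
  where open CyclicHK H isHK cyclic

[3+6n]%3≡0 : ∀ n → (3 + 6 * n) % 3 ≡ 0
[3+6n]%3≡0 n = trans (cong (_% 3) (3+6n≡[1+2n]*3 n)) (m*n%n≡0 (1 + 2 * n) 3)
  where
  3+6n≡[1+2n]*3 : ∀ n → 3 + 6 * n ≡ (1 + 2 * n) * 3
  3+6n≡[1+2n]*3 = solve-∀

proposition23 : ∀ (n : ℕ) → ¬ (Σ ℕ λ m → Σ (Fin m → ColoredPlane (3 + 6 * n)) λ H →
                  IsHK H × IsCyclic H)
proposition23 n (m , H , isHK , cyclic) = ℕ.0≢1+n (begin
  0                ≡⟨ [3+6n]%3≡0 n ⟨
  (3 + 6 * n) % 3  ≡⟨ cyclicHK-order H isHK cyclic ⟩
  1                ∎)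
  where open ≡-Reasoning
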